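{- Let $k>1$ and $1\le i\le k$. Under the action of $W$ on symmetric $2k$-cores, $$w_i^{ -1}w_{i-1}^{ -1}\cdots w_2^{ -1}w_1^{ -1}\,\emptyset=(\underbrace{i,i,\dots,i}_{i}).$$
   Context: $W$ is the affine Weyl group of type $C_k^{(1)}$ with generators $s_0,\dots,s_k$. For $1\le i\le k+1$, $w_i:=s_{i-1}s_{i-2}\cdots s_1s_0$. Action of $W$ on partitions: a cell $(r,c)$ (row $r$, column $c$) of a Young diagram has residue $d$ if $d:=(c-r)\bmod 2k\in\{0,\dots,k\}$ and residue $2k-d$ if $k<d<2k$. For a symmetric (self-conjugate) $2k$-core $\lambda$, $s_i\lambda$ is $\lambda$ with all addable cells of residue $i$ added if $\lambda$ has an addable cell of residue $i$, $\lambda$ with all removable cells of residue $i$ removed if $\lambda$ has a removable cell of residue $i$, and $\lambda$ otherwise; this defines an action of $W$ on symmetric $2k$-cores. $\emptyset$ is the empty partition. -}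

module Defs where

open import Data.Bool using (Bool; true; false; if_then_else_; _∧_; _∨_; not)
open import Data.Nat using (ℕ; zero; suc; _+_; _*_; _∸_; _≡ᵇ_; _≤ᵇ_; _<ᵇ_)
open import Data.Nat.DivMod using (_%_)
open import Data.Product using (_×_; _,_; proj₁; proj₂)
open import Data.List using (List; []; _∷_; _++_; length; map; upTo; filterᵇ; null)
open import Data.Bool.ListAction using (any)

-- A partition is the list of its (positive, weakly decreasing) row lengths.
-- Rows and columns are indexed from 1.
Partition : Set
Partition = List ℕ

-- Length of row r (1-indexed); 0 if r exceeds the number of rows (or r = 0).
row : Partition → ℕ → ℕ
row []       _             = 0
row (x ∷ xs) zero          = 0
row (x ∷ xs) (suc zero)    = x
row (x ∷ xs) (suc (suc r)) = row xs (suc r)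

-- x mod 2k (the case k = 0 is never used)
mod2k : ℕ → ℕ → ℕ
mod2k zero    x = x
mod2k (suc k) x = x % (suc k + suc k)

-- residue of cell (r,c): d := (c - r) mod 2k, computed as (c + 2k r - r) mod 2k;
-- residue is d if d ≤ k, and 2k - d otherwise.
residue : ℕ → ℕ → ℕ → ℕ
residue k r c =
  let d = mod2k k (c + (k + k) * r ∸ r)
  in if d ≤ᵇ k then d else (k + k) ∸ d

rows : ℕ → List ℕ
rows n = map suc (upTo n)

addable : Partition → List (ℕ × ℕ)
addable μ = map (λ r → (r , suc (row μ r)))
  (filterᵇ (λ r → (r ≡ᵇ 1) ∨ (row μ r <ᵇ row μ (r ∸ 1))) (rows (suc (length μ))))

removable : Partition → List (ℕ × ℕ)
removable μ = map (λ r → (r , row μ r))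
  (filterᵇ (λ r → row μ (suc r) <ᵇ row μ r) (rows (length μ)))

cellEq : ℕ × ℕ → ℕ × ℕ → Bool
cellEq (a , b) (c , d) = (a ≡ᵇ c) ∧ (b ≡ᵇ d)

_∈ᵇ_ : ℕ × ℕ → List (ℕ × ℕ) → Bool
x ∈ᵇ S = any (cellEq x) S

addCells : List (ℕ × ℕ) → Partition → Partition
addCells S μ = filterᵇ (λ x → 0 <ᵇ x)
  (map (λ r → if (r , suc (row μ r)) ∈ᵇ S then suc (row μ r) else row μ r)
       (rows (suc (length μ))))

removeCells : List (ℕ × ℕ) → Partition → Partition
removeCells S μ = filterᵇ (λ x → 0 <ᵇ x)
  (map (λ r → if (r , row μ r) ∈ᵇ S then row μ r ∸ 1 else row μ r)
       (rows (length μ)))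

-- action of the generator s_i (type C_k^(1), on symmetric 2k-cores)
sAct : (k i : ℕ) → Partition → Partition
sAct k i μ =
  let A = filterᵇ (λ c → residue k (proj₁ c) (proj₂ c) ≡ᵇ i) (addable μ)
      R = filterᵇ (λ c → residue k (proj₁ c) (proj₂ c) ≡ᵇ i) (removable μ)
  in if not (null A) then addCells A μ
     else if not (null R) then removeCells R μ
     else μ

-- A word g₁ g₂ … gₘ (list of generator indices) acts as s_{g₁} s_{g₂} ⋯ s_{gₘ},
-- i.e. the rightmost generator is applied first.
applyWord : ℕ → List ℕ → Partition → Partition
applyWord k []       μ = μ
applyWord k (g ∷ gs) μ = sAct k g (applyWord k gs μ)

-- w_j = s_{j-1} ⋯ s_1 s_0, so w_j⁻¹ = s_0 s_1 ⋯ s_{j-1}, i.e. the word 0,1,…,j-1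
wInv : ℕ → List ℕ
wInv j = upTo j

wInvProd : ℕ → List ℕ
wInvProd zero    = []
wInvProd (suc n) = wInv (suc n) ++ wInvProd n

-- Write (j^j) for the j × j square and B j t for (j^j) together with the first t
-- cells of column j+1 and the first t cells of row j+1, so B j 0 = (j^j) and
-- B j (j+1) = ((j+1)^(j+1)).  For j < k every cell (r, c) in play has residue |c − r|,
-- so the cells (t+1, j+1) and (j+1, t+1) are the addable cells of B j t of residue
-- j − t, hence s_{j−t} (B j t) = B j (t+1), and
-- w_{j+1}⁻¹ = s_0 s_1 ⋯ s_j, read from the right, grows (j^j) into ((j+1)^(j+1)).
module Submission where

open import Defs
open import Data.Bool using (Bool; true; false; if_then_else_; _∧_; _∨_; T)
open import Data.Bool.Properties using (T-≡; ∧-zeroʳ; ∧-identityʳ; ∨-identityʳ; ∨-zeroʳ)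
open import Data.Bool.ListAction using (any; or)
open import Data.Empty using (⊥-elim)
open import Data.List using (List; []; _∷_; _++_; length; map; upTo; filterᵇ; null; replicate)
open import Data.List.Properties using (map-upTo; map-∘; length-map; length-upTo; upTo-∷ʳ)
open import Data.Nat using (ℕ; zero; suc; _+_; _*_; _∸_; _≡ᵇ_; _≤ᵇ_; _<ᵇ_; _<_; _≤_; z≤n; s≤s)
open import Data.Nat.DivMod using (_%_; [m+kn]%n≡m%n; m<n⇒m%n≡m)
open import Data.Nat.Properties
open import Data.Product using (_×_; _,_; proj₁; proj₂)
open import Data.Sum using (inj₁; inj₂)
open import Function using (_∘_)
open import Function.Bundles using (Equivalence)
open import Relation.Binary using (tri<; tri≈; tri>)
open import Relation.Binary.PropositionalEquality
open import Relation.Nullary using (¬_; yes; no)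

T⇒≡true : ∀ {b} → T b → b ≡ true
T⇒≡true = Equivalence.to T-≡

¬T⇒≡false : ∀ {b} → ¬ T b → b ≡ false
¬T⇒≡false {false} _ = refl
¬T⇒≡false {true}  ¬t = ⊥-elim (¬t _)

≡ᵇ-refl : ∀ n → (n ≡ᵇ n) ≡ true
≡ᵇ-refl n = T⇒≡true (≡⇒≡ᵇ n n refl)

≢⇒≡ᵇ-false : ∀ {m n} → m ≢ n → (m ≡ᵇ n) ≡ false
≢⇒≡ᵇ-false {m} {n} m≢n = ¬T⇒≡false (m≢n ∘ ≡ᵇ⇒≡ m n)

≤⇒≤ᵇ-true : ∀ {m n} → m ≤ n → (m ≤ᵇ n) ≡ true
≤⇒≤ᵇ-true = T⇒≡true ∘ ≤⇒≤ᵇ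

>⇒≤ᵇ-false : ∀ {m n} → n < m → (m ≤ᵇ n) ≡ false
>⇒≤ᵇ-false {m} {n} n<m = ¬T⇒≡false (<⇒≱ n<m ∘ ≤ᵇ⇒≤ m n)

<⇒<ᵇ-true : ∀ {m n} → m < n → (m <ᵇ n) ≡ true
<⇒<ᵇ-true = T⇒≡true ∘ <⇒<ᵇ

≥⇒<ᵇ-false : ∀ {m n} → n ≤ m → (m <ᵇ n) ≡ false
≥⇒<ᵇ-false {m} {n} n≤m = ¬T⇒≡false (≤⇒≯ n≤m ∘ <ᵇ⇒< m n)

filterᵇ-accept : ∀ {A : Set} (p : A → Bool) {x} xs → p x ≡ true → filterᵇ p (x ∷ xs) ≡ x ∷ filterᵇ p xs
filterᵇ-accept p {x} xs px with p x
... | true = refl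

filterᵇ-reject : ∀ {A : Set} (p : A → Bool) {x} xs → p x ≡ false → filterᵇ p (x ∷ xs) ≡ filterᵇ p xs
filterᵇ-reject p {x} xs px with p x
... | false = refl

any-filterᵇ-map-filterᵇ : ∀ {A B : Set} (p q : B → Bool) (f : A → B) (c : A → Bool) (xs : List A) →
  any p (filterᵇ q (map f (filterᵇ c xs))) ≡ any (λ x → c x ∧ (q (f x) ∧ p (f x))) xs
any-filterᵇ-map-filterᵇ p q f c [] = refl
any-filterᵇ-map-filterᵇ p q f c (x ∷ xs) with c x
... | false = any-filterᵇ-map-filterᵇ p q f c xs
... | true with q (f x)
...   | false = any-filterᵇ-map-filterᵇ p q f c xs
...   | true  = cong (p (f x) ∨_) (any-filterᵇ-map-filterᵇ p q f c xs)

rows-suc : ∀ n → rows (suc n) ≡ 1 ∷ map suc (rows n)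
rows-suc n = cong (λ xs → 1 ∷ map suc xs) (sym (map-upTo suc n))

map-rows-suc : ∀ {A : Set} (f : ℕ → A) n → map f (rows (suc n)) ≡ f 1 ∷ map (f ∘ suc) (rows n)
map-rows-suc f n = trans (cong (map f) (rows-suc n)) (cong (f 1 ∷_) (sym (map-∘ (rows n))))

length-map-rows : ∀ {A : Set} (f : ℕ → A) n → length (map f (rows n)) ≡ n
length-map-rows f n = begin
  length (map f (rows n))  ≡⟨ length-map f (rows n) ⟩
  length (rows n)          ≡⟨ length-map suc (upTo n) ⟩
  length (upTo n)          ≡⟨ length-upTo n ⟩
  n                        ∎
  where open ≡-Reasoning

row-zero : ∀ μ → row μ 0 ≡ 0
row-zero []      = refl
row-zero (_ ∷ _) = refl

row-map-rows : ∀ n (f : ℕ → ℕ) r → 1 ≤ r → r ≤ n → row (map f (rows n)) r ≡ f r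
row-map-rows (suc n) f 1 _ _ = cong (λ μ → row μ 1) (map-rows-suc f n)
row-map-rows (suc n) f (suc (suc r)) _ (s≤s r≤n) =
  trans (cong (λ μ → row μ (suc (suc r))) (map-rows-suc f n))
        (row-map-rows n (f ∘ suc) (suc r) (s≤s z≤n) r≤n)

row-map-rows-beyond : ∀ n (f : ℕ → ℕ) r → n < r → row (map f (rows n)) r ≡ 0
row-map-rows-beyond zero f r _ = refl
row-map-rows-beyond (suc n) f (suc (suc r)) (s≤s n<r) =
  trans (cong (λ μ → row μ (suc (suc r))) (map-rows-suc f n))
        (row-map-rows-beyond n (f ∘ suc) (suc r) n<r)

map-rows-cong : ∀ n (f g : ℕ → ℕ) → (∀ r → 1 ≤ r → r ≤ n → f r ≡ g r) → map f (rows n) ≡ map g (rows n)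
map-rows-cong zero f g _ = refl
map-rows-cong (suc n) f g f≡g = begin
  map f (rows (suc n))          ≡⟨ map-rows-suc f n ⟩
  f 1 ∷ map (f ∘ suc) (rows n)  ≡⟨ cong₂ _∷_ (f≡g 1 (s≤s z≤n) (s≤s z≤n)) tail ⟩
  g 1 ∷ map (g ∘ suc) (rows n)  ≡⟨ sym (map-rows-suc g n) ⟩
  map g (rows (suc n))          ∎
  where
  open ≡-Reasoning
  tail = map-rows-cong n (f ∘ suc) (g ∘ suc) (λ r _ r≤n → f≡g (suc r) (s≤s z≤n) (s≤s r≤n))

filterᵇ-map-rows : ∀ N m (f : ℕ → ℕ) (p : ℕ → Bool) → m ≤ N →
  (∀ r → 1 ≤ r → r ≤ m → p (f r) ≡ true) → (∀ r → m < r → r ≤ N → p (f r) ≡ false) →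
  filterᵇ p (map f (rows N)) ≡ map f (rows m)
filterᵇ-map-rows zero zero f p _ _ _ = refl
filterᵇ-map-rows (suc N) zero f p _ _ reject = begin
  filterᵇ p (map f (rows (suc N)))          ≡⟨ cong (filterᵇ p) (map-rows-suc f N) ⟩
  filterᵇ p (f 1 ∷ map (f ∘ suc) (rows N))  ≡⟨ filterᵇ-reject p _ (reject 1 (s≤s z≤n) (s≤s z≤n)) ⟩
  filterᵇ p (map (f ∘ suc) (rows N))        ≡⟨ filterᵇ-map-rows N zero (f ∘ suc) p z≤n (λ { zero () _ ; (suc _) _ () }) reject′ ⟩
  []                                        ∎
  where
  open ≡-Reasoning
  reject′ = λ r _ r≤N → reject (suc r) (s≤s z≤n) (s≤s r≤N)
filterᵇ-map-rows (suc N) (suc m) f p (s≤s m≤N) accept reject = begin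
  filterᵇ p (map f (rows (suc N)))            ≡⟨ cong (filterᵇ p) (map-rows-suc f N) ⟩
  filterᵇ p (f 1 ∷ map (f ∘ suc) (rows N))    ≡⟨ filterᵇ-accept p _ (accept 1 (s≤s z≤n) (s≤s z≤n)) ⟩
  f 1 ∷ filterᵇ p (map (f ∘ suc) (rows N))    ≡⟨ cong (f 1 ∷_) (filterᵇ-map-rows N m (f ∘ suc) p m≤N accept′ reject′) ⟩
  f 1 ∷ map (f ∘ suc) (rows m)                ≡⟨ sym (map-rows-suc f m) ⟩
  map f (rows (suc m))                        ∎
  where
  open ≡-Reasoning
  accept′ = λ r _ r≤m → accept (suc r) (s≤s z≤n) (s≤s r≤m)
  reject′ = λ r m<r r≤N → reject (suc r) (s≤s m<r) (s≤s r≤N)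

any-rows-false : ∀ N (h : ℕ → Bool) → (∀ r → 1 ≤ r → h r ≡ false) → any h (rows N) ≡ false
any-rows-false zero h _ = refl
any-rows-false (suc N) h h≡false = begin
  any h (rows (suc N))               ≡⟨ cong or (map-rows-suc h N) ⟩
  h 1 ∨ any (h ∘ suc) (rows N)       ≡⟨ cong₂ _∨_ (h≡false 1 (s≤s z≤n)) (any-rows-false N (h ∘ suc) (λ r _ → h≡false (suc r) (s≤s z≤n))) ⟩
  false                              ∎
  where open ≡-Reasoning

any-rows-single : ∀ N (h : ℕ → Bool) r → 1 ≤ r → r ≤ N → (∀ s → s ≢ r → h s ≡ false) → any h (rows N) ≡ h r
any-rows-single (suc N) h 1 _ _ h≡false = begin
  any h (rows (suc N))               ≡⟨ cong or (map-rows-suc h N) ⟩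
  h 1 ∨ any (h ∘ suc) (rows N)       ≡⟨ cong (h 1 ∨_) (any-rows-false N (h ∘ suc) λ { (suc s) _ → h≡false (suc (suc s)) (λ ()) }) ⟩
  h 1 ∨ false                        ≡⟨ ∨-identityʳ (h 1) ⟩
  h 1                                ∎
  where open ≡-Reasoning
any-rows-single (suc N) h (suc (suc r)) _ (s≤s r≤N) h≡false = begin
  any h (rows (suc N))               ≡⟨ cong or (map-rows-suc h N) ⟩
  h 1 ∨ any (h ∘ suc) (rows N)       ≡⟨ cong (_∨ any (h ∘ suc) (rows N)) (h≡false 1 (λ ())) ⟩
  any (h ∘ suc) (rows N)             ≡⟨ any-rows-single N (h ∘ suc) (suc r) (s≤s z≤n) r≤N (λ s s≢r → h≡false (suc s) (s≢r ∘ suc-injective)) ⟩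
  h (suc (suc r))                    ∎
  where open ≡-Reasoning

any-rows-true : ∀ N (h : ℕ → Bool) r → 1 ≤ r → r ≤ N → h r ≡ true → any h (rows N) ≡ true
any-rows-true (suc N) h 1 _ _ h1 = trans (cong or (map-rows-suc h N)) (cong (_∨ any (h ∘ suc) (rows N)) h1)
any-rows-true (suc N) h (suc (suc r)) _ (s≤s r≤N) hr = begin
  any h (rows (suc N))               ≡⟨ cong or (map-rows-suc h N) ⟩
  h 1 ∨ any (h ∘ suc) (rows N)       ≡⟨ cong (h 1 ∨_) (any-rows-true N (h ∘ suc) (suc r) (s≤s z≤n) r≤N hr) ⟩
  h 1 ∨ true                         ≡⟨ ∨-zeroʳ (h 1) ⟩
  true                               ∎
  where open ≡-Reasoning

addsCellAt : ℕ → ℕ → (ℕ → ℕ) → ℕ → Bool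
addsCellAt k i h r = ((r ≡ᵇ 1) ∨ (h r <ᵇ h (r ∸ 1))) ∧ (residue k r (suc (h r)) ≡ᵇ i)

grow : Bool → ℕ → ℕ
grow b x = if b then suc x else x

growAt : ℕ → ℕ → (ℕ → ℕ) → ℕ → ℕ
growAt k i h r = grow (addsCellAt k i h r) (h r)

grow≡suc⇒true : ∀ b x → grow b x ≡ suc x → b ≡ true
grow≡suc⇒true true  x _ = refl
grow≡suc⇒true false x x≡1+x = ⊥-elim (<-irrefl x≡1+x (n<1+n x))

growAt-cong : ∀ k i {h h′ : ℕ → ℕ} → (∀ r → h r ≡ h′ r) → ∀ r → growAt k i h r ≡ growAt k i h′ r
growAt-cong k i {h} {h′} h≡h′ r
  rewrite h≡h′ r | h≡h′ (r ∸ 1) = refl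

addableRow : Partition → ℕ → Bool
addableRow μ r = (r ≡ᵇ 1) ∨ (row μ r <ᵇ row μ (r ∸ 1))

addableCell : Partition → ℕ → ℕ × ℕ
addableCell μ r = (r , suc (row μ r))

hasResidue : ℕ → ℕ → ℕ × ℕ → Bool
hasResidue k i c = residue k (proj₁ c) (proj₂ c) ≡ᵇ i

addableOfResidue : ℕ → ℕ → Partition → List (ℕ × ℕ)
addableOfResidue k i μ = filterᵇ (hasResidue k i) (addable μ)

∈ᵇ-addableOfResidue : ∀ k i μ r → 1 ≤ r → r ≤ suc (length μ) →
  (addableCell μ r ∈ᵇ addableOfResidue k i μ) ≡ addsCellAt k i (row μ) r
∈ᵇ-addableOfResidue k i μ r 1≤r r≤N = begin
  addableCell μ r ∈ᵇ addableOfResidue k i μ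
    ≡⟨ any-filterᵇ-map-filterᵇ (cellEq (cell r)) (hasResidue k i) cell (addableRow μ) (rows (suc (length μ))) ⟩
  any (λ s → addableRow μ s ∧ (hasResidue k i (cell s) ∧ cellEq (cell r) (cell s))) (rows (suc (length μ)))
    ≡⟨ any-rows-single (suc (length μ)) _ r 1≤r r≤N other-rows ⟩
  addableRow μ r ∧ (hasResidue k i (cell r) ∧ cellEq (cell r) (cell r))
    ≡⟨ cong (λ b → addableRow μ r ∧ (hasResidue k i (cell r) ∧ b)) same-cell ⟩
  addableRow μ r ∧ (hasResidue k i (cell r) ∧ true)
    ≡⟨ cong (addableRow μ r ∧_) (∧-identityʳ _) ⟩
  addsCellAt k i (row μ) r
    ∎
  where
  open ≡-Reasoning
  cell = addableCell μ
  same-cell : cellEq (cell r) (cell r) ≡ true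
  same-cell rewrite ≡ᵇ-refl r | ≡ᵇ-refl (row μ r) = refl
  other-rows : ∀ s → s ≢ r → (addableRow μ s ∧ (hasResidue k i (cell s) ∧ cellEq (cell r) (cell s))) ≡ false
  other-rows s s≢r rewrite ≢⇒≡ᵇ-false (s≢r ∘ sym) | ∧-zeroʳ (hasResidue k i (cell s)) = ∧-zeroʳ (addableRow μ s)

any-true⇒null-false : ∀ {A : Set} (p : A → Bool) xs → any p xs ≡ true → null xs ≡ false
any-true⇒null-false p (_ ∷ _) _ = refl

addableOfResidue-nonempty : ∀ k i μ r → 1 ≤ r → r ≤ suc (length μ) →
  addsCellAt k i (row μ) r ≡ true → null (addableOfResidue k i μ) ≡ false
addableOfResidue-nonempty k i μ r 1≤r r≤N adds = any-true⇒null-false (λ _ → true) _ (begin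
  any (λ _ → true) (addableOfResidue k i μ)
    ≡⟨ any-filterᵇ-map-filterᵇ (λ _ → true) (hasResidue k i) (addableCell μ) (addableRow μ) (rows (suc (length μ))) ⟩
  any (λ s → addableRow μ s ∧ (hasResidue k i (addableCell μ s) ∧ true)) (rows (suc (length μ)))
    ≡⟨ any-rows-true (suc (length μ)) _ r 1≤r r≤N (trans (cong (addableRow μ r ∧_) (∧-identityʳ _)) adds) ⟩
  true
    ∎)
  where open ≡-Reasoning

sAct-nonempty-addable : ∀ k i μ → null (addableOfResidue k i μ) ≡ false →
  sAct k i μ ≡ addCells (addableOfResidue k i μ) μ
sAct-nonempty-addable k i μ nonempty rewrite nonempty = refl

sAct-grows : ∀ k i μ m (f : ℕ → ℕ) → m ≤ suc (length μ) →
  (∀ r → 1 ≤ r → r ≤ suc (length μ) → growAt k i (row μ) r ≡ f r) →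
  (∀ r → 1 ≤ r → r ≤ m → 0 < f r) → (∀ r → m < r → f r ≡ 0) →
  ∀ r₀ → 1 ≤ r₀ → r₀ ≤ suc (length μ) → f r₀ ≡ suc (row μ r₀) →
  sAct k i μ ≡ map f (rows m)
sAct-grows k i μ m f m≤N grows positive vanishing r₀ 1≤r₀ r₀≤N grows-r₀ = begin
    sAct k i μ                           ≡⟨ sAct-nonempty-addable k i μ (addableOfResidue-nonempty k i μ r₀ 1≤r₀ r₀≤N adds-r₀) ⟩
    filterᵇ (0 <ᵇ_) (map added (rows N)) ≡⟨ cong (filterᵇ (0 <ᵇ_)) (map-rows-cong N added f added≡f) ⟩
    filterᵇ (0 <ᵇ_) (map f (rows N))     ≡⟨ filterᵇ-map-rows N m f (0 <ᵇ_) m≤N accept reject ⟩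
    map f (rows m)                       ∎
  where
  open ≡-Reasoning
  N = suc (length μ)
  adds-r₀ : addsCellAt k i (row μ) r₀ ≡ true
  adds-r₀ = grow≡suc⇒true _ (row μ r₀) (trans (grows r₀ 1≤r₀ r₀≤N) grows-r₀)
  added : ℕ → ℕ
  added r = grow (addableCell μ r ∈ᵇ addableOfResidue k i μ) (row μ r)
  added≡f : ∀ r → 1 ≤ r → r ≤ N → added r ≡ f r
  added≡f r 1≤r r≤N rewrite ∈ᵇ-addableOfResidue k i μ r 1≤r r≤N = grows r 1≤r r≤N
  accept : ∀ r → 1 ≤ r → r ≤ m → (0 <ᵇ f r) ≡ true
  accept r 1≤r r≤m = <⇒<ᵇ-true (positive r 1≤r r≤m)
  reject : ∀ r → m < r → r ≤ N → (0 <ᵇ f r) ≡ false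
  reject r m<r _ rewrite vanishing r m<r = refl

-- Residues near the diagonal

-- residue k r c unfolds to fold k (mod2k k (c + 2k r ∸ r)).
fold : ℕ → ℕ → ℕ
fold k d = if d ≤ᵇ k then d else (k + k) ∸ d

residue-upper : ∀ k′ r c → r ≤ c → c ∸ r ≤ suc k′ → residue (suc k′) r c ≡ c ∸ r
residue-upper k′ r c r≤c c∸r≤k with d , refl ← m≤n⇒∃[o]m+o≡n r≤c = begin
  fold k (((r + d) + K * r ∸ r) % K) ≡⟨ cong (λ x → fold k ((x ∸ r) % K)) (+-assoc r d (K * r)) ⟩
  fold k ((r + (d + K * r) ∸ r) % K) ≡⟨ cong (λ x → fold k (x % K)) (m+n∸m≡n r (d + K * r)) ⟩
  fold k ((d + K * r) % K)           ≡⟨ cong (λ x → fold k ((d + x) % K)) (*-comm K r) ⟩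
  fold k ((d + r * K) % K)           ≡⟨ cong (fold k) ([m+kn]%n≡m%n d r K) ⟩
  fold k (d % K)                     ≡⟨ cong (fold k) (m<n⇒m%n≡m (≤-trans (s≤s d≤k) (s≤s (m≤n+m k k′)))) ⟩
  fold k d                           ≡⟨ cong (λ b → if b then d else K ∸ d) (≤⇒≤ᵇ-true d≤k) ⟩
  d                                  ≡⟨ sym (m+n∸m≡n r d) ⟩
  r + d ∸ r                          ∎
  where
  open ≡-Reasoning
  k = suc k′
  K = k + k
  d≤k : d ≤ k
  d≤k = subst (_≤ k) (m+n∸m≡n r d) c∸r≤k

fold-reflect : ∀ k d → d ≤ k → fold k ((k + k) ∸ d) ≡ d
fold-reflect k d d≤k with m≤n⇒m<n∨m≡n d≤k
... | inj₂ refl rewrite m+n∸m≡n d d | ≤⇒≤ᵇ-true (≤-refl {d}) = refl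
... | inj₁ d<k
  rewrite >⇒≤ᵇ-false (subst (k <_) (sym (+-∸-assoc k (<⇒≤ d<k))) (m<m+n k (m<n⇒0<n∸m d<k))) =
    m∸[m∸n]≡n (≤-trans d≤k (m≤m+n k k))

residue-lower : ∀ k′ r c → c < r → r ∸ c ≤ suc k′ → residue (suc k′) r c ≡ r ∸ c
residue-lower k′ r c c<r r∸c≤k with d′ , refl ← m≤n⇒∃[o]m+o≡n c<r = begin
  fold k ((c + K * (suc c + d′) ∸ (suc c + d′)) % K) ≡⟨ cong (λ x → fold k ((c + K * x ∸ x) % K)) c+d≡r ⟩
  fold k ((c + K * (c + d) ∸ (c + d)) % K)           ≡⟨ cong (λ x → fold k (x % K)) ([m+n]∸[m+o]≡n∸o c (K * (c + d)) d) ⟩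
  fold k ((K * (c + d) ∸ d) % K)                     ≡⟨ cong (λ x → fold k ((K * x ∸ d) % K)) (+-suc c d′) ⟩
  fold k ((K * suc (c + d′) ∸ d) % K)                ≡⟨ cong (λ x → fold k ((x ∸ d) % K)) (*-suc K (c + d′)) ⟩
  fold k ((K + K * (c + d′) ∸ d) % K)                ≡⟨ cong (λ x → fold k (x % K)) (+-∸-comm (K * (c + d′)) d≤K) ⟩
  fold k (((K ∸ d) + K * (c + d′)) % K)              ≡⟨ cong (λ x → fold k (((K ∸ d) + x) % K)) (*-comm K (c + d′)) ⟩
  fold k (((K ∸ d) + (c + d′) * K) % K)              ≡⟨ cong (fold k) ([m+kn]%n≡m%n (K ∸ d) (c + d′) K) ⟩
  fold k ((K ∸ d) % K)                               ≡⟨ cong (fold k) (m<n⇒m%n≡m (∸-monoʳ-< {o = 0} (s≤s z≤n) d≤K)) ⟩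
  fold k (K ∸ d)                                     ≡⟨ fold-reflect k d d≤k ⟩
  d                                                  ≡⟨ sym r∸c≡d ⟩
  suc c + d′ ∸ c                                     ∎
  where
  open ≡-Reasoning
  k = suc k′
  K = k + k
  d = suc d′
  c+d≡r : suc c + d′ ≡ c + d
  c+d≡r = sym (+-suc c d′)
  r∸c≡d : suc c + d′ ∸ c ≡ d
  r∸c≡d = trans (cong (_∸ c) c+d≡r) (m+n∸m≡n c d)
  d≤k : d ≤ k
  d≤k = subst (_≤ k) r∸c≡d r∸c≤k
  d≤K : d ≤ K
  d≤K = ≤-trans d≤k (m≤m+n k k)

-- The shapes B j t

borderedRow : ℕ → ℕ → ℕ → ℕ
borderedRow j t zero    = 0
borderedRow j t (suc r) =
  if suc r ≤ᵇ t then suc j else if suc r ≤ᵇ j then j else if suc r ≡ᵇ suc j then t else 0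

borderedHeight : ℕ → ℕ → ℕ
borderedHeight j zero    = j
borderedHeight j (suc t) = suc j

bordered : ℕ → ℕ → Partition
bordered j t = map (borderedRow j t) (rows (borderedHeight j t))

borderedRow-≤t : ∀ j t r → 1 ≤ r → r ≤ t → borderedRow j t r ≡ suc j
borderedRow-≤t j t (suc r) _ r≤t rewrite ≤⇒≤ᵇ-true r≤t = refl

borderedRow-square : ∀ j t r → t < r → r ≤ j → borderedRow j t r ≡ j
borderedRow-square j t (suc r) t<r r≤j rewrite >⇒≤ᵇ-false t<r | ≤⇒≤ᵇ-true r≤j = refl

borderedRow-last : ∀ j t → t ≤ j → borderedRow j t (suc j) ≡ t
borderedRow-last j t t≤j rewrite >⇒≤ᵇ-false (s≤s t≤j) | >⇒≤ᵇ-false (n<1+n j) | ≡ᵇ-refl j = refl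

borderedRow-beyond : ∀ j t r → suc j < r → t ≤ suc j → borderedRow j t r ≡ 0
borderedRow-beyond j t (suc r) (s≤s j<r) t≤1+j
  rewrite >⇒≤ᵇ-false {suc r} {t} (≤-trans (s≤s t≤1+j) (s≤s j<r)) | >⇒≤ᵇ-false {suc r} {j} (m≤n⇒m≤1+n j<r)
        | ≢⇒≡ᵇ-false (λ r≡j → <-irrefl (sym r≡j) j<r) = refl

borderedRow-next : ∀ j t → t ≤ j → borderedRow j t (suc t) ≡ j
borderedRow-next j t t≤j with m≤n⇒m<n∨m≡n t≤j
... | inj₁ t<j  = borderedRow-square j t (suc t) (n<1+n t) t<j
... | inj₂ refl = borderedRow-last t t ≤-refl

borderedRow-positive : ∀ j t r → 1 ≤ t → t ≤ suc j → 1 ≤ r → r ≤ suc j → 0 < borderedRow j t r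
borderedRow-positive j t r 1≤t t≤1+j 1≤r r≤1+j with r ≤? t
... | yes r≤t rewrite borderedRow-≤t j t r 1≤r r≤t = s≤s z≤n
... | no r≰t with r ≤? j
...   | yes r≤j rewrite borderedRow-square j t r (≰⇒> r≰t) r≤j = ≤-trans 1≤r r≤j
...   | no r≰j with ≤-antisym r≤1+j (≰⇒> r≰j)
...     | refl rewrite borderedRow-last j t (≤-pred (≰⇒> r≰t)) = 1≤t

length-bordered : ∀ j t → length (bordered j t) ≡ borderedHeight j t
length-bordered j t = length-map-rows (borderedRow j t) (borderedHeight j t)

borderedHeight-bounds : ∀ j t → j ≤ borderedHeight j t × borderedHeight j t ≤ suc j
borderedHeight-bounds j zero    = ≤-refl , n≤1+n j
borderedHeight-bounds j (suc t) = n≤1+n j , ≤-refl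

row-bordered : ∀ j t → t ≤ suc j → ∀ r → row (bordered j t) r ≡ borderedRow j t r
row-bordered j t t≤1+j zero = row-zero (bordered j t)
row-bordered j t t≤1+j (suc r) with suc r ≤? borderedHeight j t
... | yes r≤h = row-map-rows (borderedHeight j t) (borderedRow j t) (suc r) (s≤s z≤n) r≤h
... | no r≰h = trans (row-map-rows-beyond _ (borderedRow j t) (suc r) (≰⇒> r≰h)) (sym (beyond t t≤1+j (≰⇒> r≰h)))
  where
  beyond : ∀ t → t ≤ suc j → borderedHeight j t < suc r → borderedRow j t (suc r) ≡ 0
  beyond zero _ (s≤s j≤r) with m≤n⇒m<n∨m≡n j≤r
  ... | inj₁ j<r  = borderedRow-beyond j zero (suc r) (s≤s j<r) z≤n
  ... | inj₂ refl = borderedRow-last j zero z≤n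
  beyond (suc t) t≤1+j h<r = borderedRow-beyond j (suc t) (suc r) h<r t≤1+j

BorderGrows : ℕ → ℕ → ℕ → ℕ → Set
BorderGrows k j t r = growAt k (j ∸ t) (borderedRow j t) r ≡ borderedRow j (suc t) r

1+j≢j∸t : ∀ j t → suc j ≢ j ∸ t
1+j≢j∸t j t 1+j≡j∸t = <-irrefl (sym 1+j≡j∸t) (s≤s (m∸n≤m j t))

grows-above : ∀ k′ j t r → suc j ≤ suc k′ → 1 ≤ r → r ≤ t → BorderGrows (suc k′) j t r
grows-above k′ j t 1 j<k _ 1≤t
  rewrite borderedRow-≤t j t 1 (s≤s z≤n) 1≤t | borderedRow-≤t j (suc t) 1 (s≤s z≤n) (m≤n⇒m≤1+n 1≤t)
        | residue-upper k′ 1 (suc (suc j)) (s≤s z≤n) j<k | ≢⇒≡ᵇ-false (1+j≢j∸t j t) = refl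
grows-above k′ j t (suc (suc r)) _ _ r<t
  rewrite borderedRow-≤t j t (suc (suc r)) (s≤s z≤n) r<t | borderedRow-≤t j t (suc r) (s≤s z≤n) (≤-trans (n≤1+n (suc r)) r<t)
        | borderedRow-≤t j (suc t) (suc (suc r)) (s≤s z≤n) (m≤n⇒m≤1+n r<t) | ≥⇒<ᵇ-false (≤-refl {suc j}) = refl

grows-column-cell : ∀ k′ j t → t ≤ j → suc j ≤ suc k′ → BorderGrows (suc k′) j t (suc t)
grows-column-cell k′ j zero t≤j j<k
  rewrite borderedRow-next j zero t≤j | borderedRow-≤t j 1 1 (s≤s z≤n) ≤-refl
        | residue-upper k′ 1 (suc j) (s≤s z≤n) (≤-trans (n≤1+n j) j<k) | ≡ᵇ-refl j = refl
grows-column-cell k′ j (suc t) t≤j j<k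
  rewrite borderedRow-next j (suc t) t≤j | borderedRow-≤t j (suc (suc t)) (suc (suc t)) (s≤s z≤n) ≤-refl
        | borderedRow-≤t j (suc t) (suc t) (s≤s z≤n) ≤-refl | <⇒<ᵇ-true (n<1+n j)
        | residue-upper k′ (suc (suc t)) (suc j) (s≤s t≤j) (≤-trans (m∸n≤m j (suc t)) (≤-trans (n≤1+n j) j<k))
        | ≡ᵇ-refl (j ∸ suc t) = refl

grows-inside : ∀ k′ j t r → suc t < r → r ≤ j → BorderGrows (suc k′) j t r
grows-inside k′ j t 1 (s≤s ()) _
grows-inside k′ j t (suc (suc r)) 1+t<r r≤j
  rewrite borderedRow-square j t (suc (suc r)) (≤-trans (n≤1+n (suc t)) 1+t<r) r≤j
        | borderedRow-square j t (suc r) (≤-pred 1+t<r) (≤-trans (n≤1+n (suc r)) r≤j)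
        | borderedRow-square j (suc t) (suc (suc r)) 1+t<r r≤j | ≥⇒<ᵇ-false (≤-refl {j}) = refl

grows-row-cell : ∀ k′ j t → t < j → suc j ≤ suc k′ → BorderGrows (suc k′) j t (suc j)
grows-row-cell k′ (suc j) t t<j j<k
  rewrite borderedRow-last (suc j) t (<⇒≤ t<j) | borderedRow-square (suc j) t (suc j) t<j ≤-refl
        | borderedRow-last (suc j) (suc t) t<j | <⇒<ᵇ-true t<j
        | residue-lower k′ (suc (suc j)) (suc t) (s≤s t<j) (≤-trans (m∸n≤m (suc j) t) (≤-trans (n≤1+n (suc j)) j<k))
        | ≡ᵇ-refl (suc j ∸ t) = refl

grows-below : ∀ k′ j t → t ≤ j → suc j ≤ suc k′ → BorderGrows (suc k′) j t (suc (suc j))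
grows-below k′ j t t≤j j<k
  rewrite borderedRow-beyond j t (suc (suc j)) ≤-refl (m≤n⇒m≤1+n t≤j)
        | borderedRow-beyond j (suc t) (suc (suc j)) ≤-refl (s≤s t≤j)
        | residue-lower k′ (suc (suc j)) 1 (s≤s (s≤s z≤n)) j<k | ≢⇒≡ᵇ-false (1+j≢j∸t j t)
        | ∧-zeroʳ ((suc j ≡ᵇ 0) ∨ (0 <ᵇ borderedRow j t (suc j))) = refl

bordered-grows : ∀ k′ j t r → t ≤ j → suc j ≤ suc k′ → 1 ≤ r → r ≤ suc (suc j) → BorderGrows (suc k′) j t r
bordered-grows k′ j t r t≤j j<k 1≤r r≤2+j with <-cmp r (suc t)
... | tri< r<1+t _ _ = grows-above k′ j t r j<k 1≤r (≤-pred r<1+t)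
... | tri≈ _ refl _ = grows-column-cell k′ j t t≤j j<k
... | tri> _ _ 1+t<r with r ≤? j | m≤n⇒m<n∨m≡n r≤2+j
...   | yes r≤j | _         = grows-inside k′ j t r 1+t<r r≤j
...   | no _    | inj₂ refl = grows-below k′ j t t≤j j<k
...   | no r≰j  | inj₁ r<2+j with ≤-antisym (≤-pred r<2+j) (≰⇒> r≰j)
...     | refl = grows-row-cell k′ j t (≤-pred 1+t<r) j<k

sAct-bordered : ∀ k′ j t → t ≤ j → suc j ≤ suc k′ → sAct (suc k′) (j ∸ t) (bordered j t) ≡ bordered j (suc t)
sAct-bordered k′ j t t≤j j<k =
  sAct-grows (suc k′) (j ∸ t) μ (suc j) (borderedRow j (suc t)) (s≤s j≤ℓ)
    (λ r 1≤r r≤1+ℓ → trans (growAt-cong (suc k′) (j ∸ t) (row-bordered j t t≤1+j) r)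
                           (bordered-grows k′ j t r t≤j j<k 1≤r (≤-trans r≤1+ℓ (s≤s ℓ≤1+j))))
    (λ r → borderedRow-positive j (suc t) r (s≤s z≤n) (s≤s t≤j))
    (λ r 1+j<r → borderedRow-beyond j (suc t) r 1+j<r (s≤s t≤j))
    (suc t) (s≤s z≤n) (s≤s (≤-trans t≤j j≤ℓ)) column-cell-added
  where
  μ = bordered j t
  t≤1+j = m≤n⇒m≤1+n t≤j
  j≤ℓ : j ≤ length μ
  j≤ℓ = subst (j ≤_) (sym (length-bordered j t)) (proj₁ (borderedHeight-bounds j t))
  ℓ≤1+j : length μ ≤ suc j
  ℓ≤1+j = subst (_≤ suc j) (sym (length-bordered j t)) (proj₂ (borderedHeight-bounds j t))
  column-cell-added : borderedRow j (suc t) (suc t) ≡ suc (row μ (suc t))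
  column-cell-added = begin
    borderedRow j (suc t) (suc t) ≡⟨ borderedRow-≤t j (suc t) (suc t) (s≤s z≤n) ≤-refl ⟩
    suc j                         ≡⟨ cong suc (borderedRow-next j t t≤j) ⟨
    suc (borderedRow j t (suc t)) ≡⟨ cong suc (row-bordered j t t≤1+j (suc t)) ⟨
    suc (row μ (suc t))           ∎
    where open ≡-Reasoning

applyWord-++ : ∀ k ws vs μ → applyWord k (ws ++ vs) μ ≡ applyWord k ws (applyWord k vs μ)
applyWord-++ k []       vs μ = refl
applyWord-++ k (w ∷ ws) vs μ = cong (sAct k w) (applyWord-++ k ws vs μ)

applyWord-upTo-bordered : ∀ k′ j m → m ≤ suc j → suc j ≤ suc k′ →
  applyWord (suc k′) (upTo m) (bordered j (suc j ∸ m)) ≡ bordered j (suc j)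
applyWord-upTo-bordered k′ j zero    _         _   = refl
applyWord-upTo-bordered k′ j (suc m) (s≤s m≤j) j<k = begin
  applyWord k (upTo (suc m)) (bordered j (j ∸ m))            ≡⟨ cong (λ w → applyWord k w (bordered j (j ∸ m))) (upTo-∷ʳ m) ⟨
  applyWord k (upTo m ++ m ∷ []) (bordered j (j ∸ m))        ≡⟨ applyWord-++ k (upTo m) (m ∷ []) (bordered j (j ∸ m)) ⟩
  applyWord k (upTo m) (sAct k m (bordered j (j ∸ m)))       ≡⟨ cong (λ i → applyWord k (upTo m) (sAct k i (bordered j (j ∸ m)))) (m∸[m∸n]≡n m≤j) ⟨
  applyWord k (upTo m) (sAct k (j ∸ (j ∸ m)) (bordered j (j ∸ m)))
    ≡⟨ cong (applyWord k (upTo m)) (sAct-bordered k′ j (j ∸ m) (m∸n≤m j m) j<k) ⟩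
  applyWord k (upTo m) (bordered j (suc (j ∸ m)))            ≡⟨ cong (λ t → applyWord k (upTo m) (bordered j t)) (+-∸-assoc 1 m≤j) ⟨
  applyWord k (upTo m) (bordered j (suc j ∸ m))              ≡⟨ applyWord-upTo-bordered k′ j m (m≤n⇒m≤1+n m≤j) j<k ⟩
  bordered j (suc j)                                         ∎
  where
  open ≡-Reasoning
  k = suc k′

bordered-complete : ∀ j → bordered j (suc j) ≡ bordered (suc j) 0
bordered-complete j = map-rows-cong (suc j) (borderedRow j (suc j)) (borderedRow (suc j) 0)
  (λ r 1≤r r≤1+j → trans (borderedRow-≤t j (suc j) r 1≤r r≤1+j) (sym (borderedRow-square (suc j) 0 r 1≤r r≤1+j)))

bordered-square : ∀ i → bordered i 0 ≡ replicate i i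
bordered-square i = trans (map-rows-cong i (borderedRow i 0) (λ _ → i) (borderedRow-square i 0)) (map-rows-const i)
  where
  map-rows-const : ∀ n → map (λ _ → i) (rows n) ≡ replicate n i
  map-rows-const zero    = refl
  map-rows-const (suc n) = trans (map-rows-suc (λ _ → i) n) (cong (i ∷_) (map-rows-const n))

applyWord-wInvProd : ∀ k′ n → n ≤ suc k′ → applyWord (suc k′) (wInvProd n) [] ≡ bordered n 0
applyWord-wInvProd k′ zero    _   = refl
applyWord-wInvProd k′ (suc n) n<k = begin
  applyWord k (upTo (suc n) ++ wInvProd n) []           ≡⟨ applyWord-++ k (upTo (suc n)) (wInvProd n) [] ⟩
  applyWord k (upTo (suc n)) (applyWord k (wInvProd n) []) ≡⟨ cong (applyWord k (upTo (suc n))) (applyWord-wInvProd k′ n (<⇒≤ n<k)) ⟩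
  applyWord k (upTo (suc n)) (bordered n 0)             ≡⟨ cong (λ t → applyWord k (upTo (suc n)) (bordered n t)) (n∸n≡0 n) ⟨
  applyWord k (upTo (suc n)) (bordered n (suc n ∸ suc n)) ≡⟨ applyWord-upTo-bordered k′ n (suc n) ≤-refl n<k ⟩
  bordered n (suc n)                                    ≡⟨ bordered-complete n ⟩
  bordered (suc n) 0                                    ∎
  where
  open ≡-Reasoning
  k = suc k′

lemma3p12 : (k i : ℕ) → 1 < k → 1 ≤ i → i ≤ k →
    applyWord k (wInvProd i) [] ≡ replicate i i
lemma3p12 (suc k′) i _ _ i≤k = trans (applyWord-wInvProd k′ i i≤k) (bordered-square i)
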